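{- Let $d$ be a positive integer, let $G=(V,E)$ be a finite connected graph with vertices $v_1,\dots,v_n$ and edges $e_1,\dots,e_m$, let $A_G$ be its incidence matrix, and let $f_E:E\to\mathbb{Z}_d$ be an e-labeling. The following statements are equivalent: (i) $(G,f_E)$ is compatible. (ii) $\langle \pi_d(\omega_C),f_E\rangle\equiv 0\pmod d$ for every cycle $C$ of $G$ for which $\omega_C$ is defined (every cycle of even length, and, when $d$ is even, also every cycle of odd length). (iii) $\langle \omega,f_E\rangle\equiv 0\pmod d$ for all $\omega\in\ker_{\mathbb{Z}_d}(A_G)$. (iv) Let $S$ be a finite set of generators of $\ker_{\mathbb{Z}}(A_G)$. If $d$ is odd or $G$ has no cycles of odd length: $\langle\omega,f_E\rangle\equiv 0\pmod d$ for all $\omega\in\pi_d(S)$. If $d$ is even and $G$ has a cycle of odd length: $\langle\omega,f_E\rangle\equiv0\pmod d$ for all $\omega\in\pi_d(S)$ and for $\omega=\pi_d(\omega_C)$ for some cycle $C$ of odd length. (v) $(G,f_E)$ is additive.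
   Context: $\mathbb{Z}_d$ denotes the integers modulo $d$. A v-labeling $f_V:V\to\mathbb{Z}_d$ is valid for $(G,f_E)$ if $f_E((v,v'))\equiv f_V(v)+f_V(v')\pmod d$ for every edge $(v,v')$; $(G,f_E)$ is additive if a valid v-labeling exists. A cycle of length $k$ is a closed walk, not necessarily simple: vertices $v_1,\dots,v_k$ (repetitions allowed) and edges $e_1,\dots,e_k$ with $e_i=(v_i,v_{i+1})$ for $i<k$ and $e_k=(v_k,v_1)$. Even cycle property: every cycle of even length with edges $e_1,\dots,e_{2k}$ satisfies $\sum_{l\text{ odd}}f_E(e_l)\equiv\sum_{l\text{ even}}f_E(e_l)\pmod d$. Odd cycle property ($d$ even): every cycle of odd length with edges $e_1,\dots,e_{2k+1}$ satisfies $\frac d2\sum_l f_E(e_l)\equiv0\pmod d$. Compatible: $d$ odd and the even cycle property holds, or $d$ even and both properties hold. The incidence matrix $A_G\in\mathbb{Z}^{n\times m}$ has $(i,j)$ entry $1$ if $v_i$ is incident with $e_j$ and $0$ otherwise. $\ker_{\mathbb{Z}}(A_G)=\{x\in\mathbb{Z}^m: A_Gx=0\}$, $\ker_{\mathbb{Z}_d}(A_G)=\{x\in\mathbb{Z}_d^m: A_Gx\equiv0\pmod d\}$, and $\pi_d:\mathbb{Z}^m\to\mathbb{Z}_d^m$ is coordinatewise reduction mod $d$. For $\omega$ indexed by edges, $\langle\omega,f_E\rangle=\sum_{e\in E}\omega_e f_E(e)$. For a cycle $C$ with consecutive edges $e_1,\dots,e_k$ (starting at any edge): if $k$ is even, attach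 the coefficient $(-1)^{i+1}$ to $e_i$; if $k$ is odd and $d$ is even, attach the coefficient $d/2$ to each $e_i$. Then $\omega_C\in\mathbb{Z}^m$ has, for each edge $e$ of $G$, coordinate $(\omega_C)_e$ equal to the sum of the coefficients attached to all occurrences of $e$ in $e_1,\dots,e_k$ (and $0$ if $e$ does not occur). (For even cycles $\omega_C$ is defined up to sign.) -}

module Defs where

open import Data.Nat as ℕ using (ℕ; zero; suc; NonZero; _≥_)
open import Data.Nat.Divisibility as ℕD using ()
open import Data.Nat.DivMod as ℕDM using ()
open import Data.Integer as ℤ using (ℤ; +_; 0ℤ; 1ℤ; -1ℤ; _*_; _+_; _-_)
open import Data.Integer.Divisibility using (_∣_)
open import Data.Integer.DivMod using (_%ℕ_; n%ℕd<d)
open import Data.Fin as Fin using (Fin; toℕ; fromℕ; fromℕ<; inject₁; _≟_)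
open import Data.Product using (Σ; ∃; ∃-syntax; _×_; _,_; proj₁; proj₂)
open import Data.Sum using (_⊎_)
open import Data.Bool using (Bool; true; false; if_then_else_; _∨_)
open import Relation.Nullary using (¬_; does)
open import Relation.Binary.PropositionalEquality using (_≡_; _≢_)

-- Integers modulo d.  ℤ_d is represented by Fin d (residues 0,…,d-1);
-- arithmetic in ℤ_d is carried out in ℤ on the representatives and
-- compared with the congruence below.

infix 4 _≡_[mod_]
_≡_[mod_] : ℤ → ℤ → ℕ → Set
x ≡ y [mod d ] = (+ d) ∣ (x - y)

⌜_⌝ : {d : ℕ} → Fin d → ℤ
⌜ a ⌝ = + toℕ a

red : (d : ℕ) .{{_ : NonZero d}} → ℤ → Fin d
red d x = fromℕ< (n%ℕd<d x d)

π : (d : ℕ) .{{_ : NonZero d}} {m : ℕ} → (Fin m → ℤ) → (Fin m → Fin d)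
π d ω e = red d (ω e)

Even : ℕ → Set
Even d = 2 ℕD.∣ d

Odd : ℕ → Set
Odd d = ¬ Even d

Σℤ : (k : ℕ) → (Fin k → ℤ) → ℤ
Σℤ zero    f = 0ℤ
Σℤ (suc k) f = f Fin.zero + Σℤ k (λ i → f (Fin.suc i))

-- ⟨ω, f⟩ for an integer vector ω and a labelling in ℤ_d (computed on
-- representatives; only its class mod d is ever used)
⟨_,_⟩ : {m d : ℕ} → (Fin m → ℤ) → (Fin m → Fin d) → ℤ
⟨_,_⟩ {m} ω f = Σℤ m (λ e → ω e * ⌜ f e ⌝)

⟨_,_⟩d : {m d : ℕ} → (Fin m → Fin d) → (Fin m → Fin d) → ℤ
⟨_,_⟩d {m} ω f = Σℤ m (λ e → ⌜ ω e ⌝ * ⌜ f e ⌝)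

record Graph (n m : ℕ) : Set where
  field
    ends     : Fin m → Fin n × Fin n
    noLoop   : ∀ e → proj₁ (ends e) ≢ proj₂ (ends e)
    noMulti  : ∀ e e' →
               ((proj₁ (ends e) ≡ proj₁ (ends e') × proj₂ (ends e) ≡ proj₂ (ends e'))
                ⊎ (proj₁ (ends e) ≡ proj₂ (ends e') × proj₂ (ends e) ≡ proj₁ (ends e')))
               → e ≡ e'
open Graph public

Joins : {n m : ℕ} → Graph n m → Fin m → Fin n → Fin n → Set
Joins G e u w =
  (proj₁ (ends G e) ≡ u × proj₂ (ends G e) ≡ w) ⊎
  (proj₁ (ends G e) ≡ w × proj₂ (ends G e) ≡ u)

record Walk {n m : ℕ} (G : Graph n m) : Set where
  field
    len   : ℕ
    verts : Fin (suc len) → Fin n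
    edges : Fin len → Fin m
    adj   : ∀ i → Joins G (edges i) (verts (inject₁ i)) (verts (Fin.suc i))
open Walk public

Connected : {n m : ℕ} → Graph n m → Set
Connected G = ∀ u v → Σ (Walk G) λ W →
  verts W Fin.zero ≡ u × verts W (fromℕ (len W)) ≡ v

-- A cycle of length k ≥ 1 (closed walk, repetitions allowed):
-- vertices v_1,…,v_k, edges e_1,…,e_k, e_i = (v_i,v_{i+1}), e_k = (v_k,v_1).
record Cycle {n m : ℕ} (G : Graph n m) : Set where
  field
    walk     : Walk G
    nonempty : len walk ≥ 1
    closed   : verts walk (fromℕ (len walk)) ≡ verts walk Fin.zero
open Cycle public

cycLen : {n m : ℕ} {G : Graph n m} → Cycle G → ℕ
cycLen C = len (walk C)

-- i-th edge (0-based index i, i.e. e_{i+1} in the paper's numbering)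
cycEdge : {n m : ℕ} {G : Graph n m} (C : Cycle G) → Fin (cycLen C) → Fin m
cycEdge C = edges (walk C)

EvenCycle : {n m : ℕ} {G : Graph n m} → Cycle G → Set
EvenCycle C = Even (cycLen C)

OddCycle : {n m : ℕ} {G : Graph n m} → Cycle G → Set
OddCycle C = Odd (cycLen C)

-- 0-based index i is even  ⇔  paper index l = i+1 is odd
evenIdx : {k : ℕ} → Fin k → Bool
evenIdx i = ℕ._≡ᵇ_ (toℕ i ℕDM.% 2) 0

ELabel : (d n m : ℕ) → Set
ELabel d n m = Fin m → Fin d

VLabel : (d n : ℕ) → Set
VLabel d n = Fin n → Fin d

ValidV : {d n m : ℕ} → Graph n m → ELabel d n m → VLabel d n → Set
ValidV {d} G fE fV = ∀ e →
  ⌜ fE e ⌝ ≡ ⌜ fV (proj₁ (ends G e)) ⌝ + ⌜ fV (proj₂ (ends G e)) ⌝ [mod d ]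

Additive : {d n m : ℕ} → Graph n m → ELabel d n m → Set
Additive {d} {n} G fE = Σ (VLabel d n) (ValidV G fE)

EvenCycleProperty : {d n m : ℕ} → Graph n m → ELabel d n m → Set
EvenCycleProperty {d} G fE = ∀ (C : Cycle G) → EvenCycle C →
  Σℤ (cycLen C) (λ i → if evenIdx i then ⌜ fE (cycEdge C i) ⌝ else 0ℤ)
  ≡ Σℤ (cycLen C) (λ i → if evenIdx i then 0ℤ else ⌜ fE (cycEdge C i) ⌝) [mod d ]

-- (d/2) Σ_l f(e_l) ≡ 0 for odd cycles (meaningful for d even)
OddCycleProperty : {d n m : ℕ} → Graph n m → ELabel d n m → Set
OddCycleProperty {d} G fE = ∀ (C : Cycle G) → OddCycle C →
  + (d ℕDM./ 2) * Σℤ (cycLen C) (λ i → ⌜ fE (cycEdge C i) ⌝) ≡ 0ℤ [mod d ]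

Compatible : {d n m : ℕ} → Graph n m → ELabel d n m → Set
Compatible {d} G fE =
  (Odd d × EvenCycleProperty G fE) ⊎
  (Even d × EvenCycleProperty G fE × OddCycleProperty G fE)

ind : {m : ℕ} → Fin m → Fin m → ℤ
ind e e' = if does (e ≟ e') then 1ℤ else 0ℤ

-- even cycle: coefficient (-1)^{l+1} on e_l (paper index l = i+1)
ωEven : {n m : ℕ} {G : Graph n m} → Cycle G → Fin m → ℤ
ωEven C e = Σℤ (cycLen C) (λ i →
  ind (cycEdge C i) e * (if evenIdx i then 1ℤ else -1ℤ))

ωOdd : (d : ℕ) {n m : ℕ} {G : Graph n m} → Cycle G → Fin m → ℤ
ωOdd d C e = Σℤ (cycLen C) (λ i → ind (cycEdge C i) e * + (d ℕDM./ 2))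

incidence : {n m : ℕ} → Graph n m → Fin n → Fin m → ℤ
incidence G i j =
  if does (i ≟ proj₁ (ends G j)) ∨ does (i ≟ proj₂ (ends G j)) then 1ℤ else 0ℤ

InKerℤ : {n m : ℕ} → Graph n m → (Fin m → ℤ) → Set
InKerℤ {n} {m} G x = ∀ i → Σℤ m (λ j → incidence G i j * x j) ≡ 0ℤ

InKerℤd : (d : ℕ) {n m : ℕ} → Graph n m → (Fin m → Fin d) → Set
InKerℤd d {n} {m} G x = ∀ i → Σℤ m (λ j → incidence G i j * ⌜ x j ⌝) ≡ 0ℤ [mod d ]

GeneratesKer : {n m : ℕ} → Graph n m → (s : ℕ) → (Fin s → (Fin m → ℤ)) → Set
GeneratesKer {n} {m} G s S =
  (∀ t → InKerℤ G (S t)) ×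
  (∀ x → InKerℤ G x → Σ (Fin s → ℤ) λ c → ∀ e → x e ≡ Σℤ s (λ t → c t * S t e))

HasOddCycle : {n m : ℕ} → Graph n m → Set
HasOddCycle G = Σ (Cycle G) OddCycle

Cond-i : {d n m : ℕ} → Graph n m → ELabel d n m → Set
Cond-i G fE = Compatible G fE

Cond-ii : (d : ℕ) .{{_ : NonZero d}} {n m : ℕ} → Graph n m → ELabel d n m → Set
Cond-ii d G fE =
  (∀ (C : Cycle G) → EvenCycle C → ⟨ π d (ωEven C) , fE ⟩d ≡ 0ℤ [mod d ]) ×
  (Even d → ∀ (C : Cycle G) → OddCycle C → ⟨ π d (ωOdd d C) , fE ⟩d ≡ 0ℤ [mod d ])

Cond-iii : (d : ℕ) {n m : ℕ} → Graph n m → ELabel d n m → Set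
Cond-iii d G fE = ∀ ω → InKerℤd d G ω → ⟨ ω , fE ⟩d ≡ 0ℤ [mod d ]

Cond-iv : (d : ℕ) .{{_ : NonZero d}} {n m : ℕ} → Graph n m → ELabel d n m →
          (s : ℕ) → (Fin s → (Fin m → ℤ)) → Set
Cond-iv d G fE s S =
  ((Odd d ⊎ ¬ HasOddCycle G) → AllS) ×
  ((Even d × HasOddCycle G) →
     AllS × Σ (Cycle G) λ C → OddCycle C × (⟨ π d (ωOdd d C) , fE ⟩d ≡ 0ℤ [mod d ]))
  where
  AllS = ∀ t → ⟨ π d (S t) , fE ⟩d ≡ 0ℤ [mod d ]

Cond-v : {d n m : ℕ} → Graph n m → ELabel d n m → Set
Cond-v G fE = Additive G fE

-- The cheap implications are linear algebra: (v) ⇒ (iii) because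
-- ⟨ω, f_E⟩ = ⟨A_Gᵀ f_V, ω⟩ = ⟨f_V, A_G ω⟩; (iii) ⇒ (ii) because ω_C lies
-- in the kernel; (ii) ⇒ (i) because ⟨ω_C, f_E⟩ is exactly the alternating
-- (even C) or halved (odd C) edge sum of C; (iii) ⇒ (iv) trivially.
-- The substance is (i) ⇒ (v): a v-labelling is built by transporting a
-- value from a root along paths, where crossing an edge e maps x to
-- f_E(e) - x.  Transport around a closed walk is the identity (even
-- length, by the even cycle property) or a reflection x ↦ a - x (odd
-- length); a root value c with 2c ≡ a for one, hence every, odd closed
-- walk exists (2 is a unit for odd d; a is even by the odd cycle
-- property for even d) and yields a valid labelling.  For (iv) ⇒ (i),
-- the even cycle property follows from the kernel being generated by S,
-- and the odd cycle property for every odd cycle from the given one by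
-- a parity argument on the closed walk C₀ · P · C · P⁻¹.

module Submission where

open import Defs
open import Data.Nat as ℕ using (ℕ; zero; suc; NonZero)
import Data.Nat.Divisibility as ℕD
import Data.Nat.Properties as ℕP
import Data.Nat.DivMod as ℕDM
open import Data.Integer using (ℤ; +_; 0ℤ; 1ℤ; -1ℤ; _*_; _+_; _-_; -_)
import Data.Integer.Properties as ℤP
open import Data.Integer.Tactic.RingSolver using (solve-∀)
open import Data.Integer.Divisibility.Signed
  using (_∣_; divides; ∣ᵤ⇒∣; ∣⇒∣ᵤ; ∣-refl; ∣-trans; ∣m∣n⇒∣m+n; ∣m∣n⇒∣m-n; ∣n⇒∣m*n; ∣m⇒∣m*n)
open import Data.Integer.DivMod using (_/ℕ_; n%ℕd<d; a≡a%ℕn+[a/ℕn]*n)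
open import Data.Fin as Fin using (Fin; toℕ; fromℕ; inject₁; _≟_)
open import Data.Fin.Properties using (toℕ-fromℕ<; ¬Fin0; any?)
open import Data.Product using (Σ; _×_; _,_; proj₁; proj₂)
open import Data.Sum using (inj₁; inj₂)
open import Function.Bundles using (_⇔_; mk⇔; Equivalence)
open import Data.Bool using (true; false; if_then_else_; not)
open import Data.Empty using (⊥-elim)
open import Relation.Nullary using (¬_; ¬?; yes; no)
open import Relation.Nullary.Decidable using (decidable-stable; ¬¬-excluded-middle)
open import Function using (_∘_)
open import Relation.Binary.Bundles using (Setoid)
open import Relation.Binary.Structures using (IsEquivalence)
open import Relation.Binary.PropositionalEquality
open import Algebra.Properties.Semiring.Sum ℤP.+-*-semiring
  using (sum; ∑-distrib-+; ∑-comm; *-distribˡ-sum; sum-replicate-zero)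

-- Defs phrases x ≡ y [mod d] through unsigned
-- divisibility, whose unfolding hides x and y from unification; we work
-- with a record wrapping the signed divisibility d ∣ x - y instead and
-- convert only at the interface.

infix 4 _≈[_]_
record _≈[_]_ (x : ℤ) (d : ℕ) (y : ℤ) : Set where
  constructor congruent
  field divisible : + d ∣ (x - y)
open _≈[_]_

module _ {d : ℕ} where

  toMod : ∀ {x y} → x ≈[ d ] y → x ≡ y [mod d ]
  toMod p = ∣⇒∣ᵤ (divisible p)

  fromMod : ∀ {x y} → x ≡ y [mod d ] → x ≈[ d ] y
  fromMod p = congruent (∣ᵤ⇒∣ p)

  mod-via : ∀ {x y z} → z ≡ x - y → + d ∣ z → x ≈[ d ] y
  mod-via eq p = congruent (subst (+ d ∣_) eq p)

  mod-by-multiple : ∀ {x y} k → x ≡ y + k * + d → x ≈[ d ] y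
  mod-by-multiple {x} {y} k eq = congruent (divides k (trans (cong (_- y) eq) (lemma y (k * + d))))
    where
    lemma : ∀ a b → a + b - a ≡ b
    lemma = solve-∀

  ≡⇒≈ : ∀ {x y} → x ≡ y → x ≈[ d ] y
  ≡⇒≈ {x} refl = mod-by-multiple 0ℤ (sym (ℤP.+-identityʳ x))

  ≈-refl : ∀ {x} → x ≈[ d ] x
  ≈-refl = ≡⇒≈ refl

  ≈-sym : ∀ {x y} → x ≈[ d ] y → y ≈[ d ] x
  ≈-sym {x} {y} p = mod-via (lemma x y) (∣n⇒∣m*n -1ℤ (divisible p))
    where
    lemma : ∀ a b → -1ℤ * (a - b) ≡ b - a
    lemma = solve-∀

  ≈-trans : ∀ {x y z} → x ≈[ d ] y → y ≈[ d ] z → x ≈[ d ] z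
  ≈-trans {x} {y} {z} p q = mod-via (lemma x y z) (∣m∣n⇒∣m+n (divisible p) (divisible q))
    where
    lemma : ∀ a b c → (a - b) + (b - c) ≡ a - c
    lemma = solve-∀

  ≈-+ : ∀ {x y u v} → x ≈[ d ] y → u ≈[ d ] v → x + u ≈[ d ] y + v
  ≈-+ {x} {y} {u} {v} p q = mod-via (lemma x y u v) (∣m∣n⇒∣m+n (divisible p) (divisible q))
    where
    lemma : ∀ a b c e → (a - b) + (c - e) ≡ (a + c) - (b + e)
    lemma = solve-∀

  ≈-- : ∀ {x y u v} → x ≈[ d ] y → u ≈[ d ] v → x - u ≈[ d ] y - v
  ≈-- {x} {y} {u} {v} p q = mod-via (lemma x y u v) (∣m∣n⇒∣m-n (divisible p) (divisible q))
    where
    lemma : ∀ a b c e → (a - b) - (c - e) ≡ (a - c) - (b - e)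
    lemma = solve-∀

  ≈-* : ∀ {x y u v} → x ≈[ d ] y → u ≈[ d ] v → x * u ≈[ d ] y * v
  ≈-* {x} {y} {u} {v} p q =
    mod-via (lemma x y u v) (∣m∣n⇒∣m+n (∣n⇒∣m*n x (divisible q)) (∣m⇒∣m*n v (divisible p)))
    where
    lemma : ∀ a b c e → a * (c - e) + (a - b) * e ≡ a * c - b * e
    lemma = solve-∀

  ≈-isEquivalence : IsEquivalence (λ x y → x ≈[ d ] y)
  ≈-isEquivalence = record { refl = ≈-refl ; sym = ≈-sym ; trans = ≈-trans }

≈-setoid : ℕ → Setoid _ _
≈-setoid d = record { isEquivalence = ≈-isEquivalence {d} }

module ≈-Reasoning (d : ℕ) where
  open import Relation.Binary.Reasoning.Setoid (≈-setoid d) public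

red-≈ : ∀ (d : ℕ) .{{_ : NonZero d}} x → ⌜ red d x ⌝ ≈[ d ] x
red-≈ d x = ≈-sym (mod-by-multiple (x /ℕ d)
  (trans (a≡a%ℕn+[a/ℕn]*n x d) (cong (λ r → + r + (x /ℕ d) * + d) (sym (toℕ-fromℕ< (n%ℕd<d x d))))))

Σℤ≡sum : ∀ k (f : Fin k → ℤ) → Σℤ k f ≡ sum f
Σℤ≡sum zero    f = refl
Σℤ≡sum (suc k) f = cong (λ t → f Fin.zero + t) (Σℤ≡sum k _)

Σ-cong : ∀ k {f g : Fin k → ℤ} → (∀ i → f i ≡ g i) → Σℤ k f ≡ Σℤ k g
Σ-cong zero    p = refl
Σ-cong (suc k) p = cong₂ _+_ (p Fin.zero) (Σ-cong k (λ i → p (Fin.suc i)))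

Σ-cong-≈ : ∀ {d} k {f g : Fin k → ℤ} → (∀ i → f i ≈[ d ] g i) → Σℤ k f ≈[ d ] Σℤ k g
Σ-cong-≈ zero    p = ≈-refl
Σ-cong-≈ (suc k) p = ≈-+ (p Fin.zero) (Σ-cong-≈ k (λ i → p (Fin.suc i)))

Σ-zero : ∀ k → Σℤ k (λ _ → 0ℤ) ≡ 0ℤ
Σ-zero k = trans (Σℤ≡sum k _) (sum-replicate-zero k)

Σ-≈0 : ∀ {d} k {f : Fin k → ℤ} → (∀ i → f i ≈[ d ] 0ℤ) → Σℤ k f ≈[ d ] 0ℤ
Σ-≈0 k p = ≈-trans (Σ-cong-≈ k p) (≡⇒≈ (Σ-zero k))

Σ-+ : ∀ k (f g : Fin k → ℤ) → Σℤ k (λ i → f i + g i) ≡ Σℤ k f + Σℤ k g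
Σ-+ k f g = trans (Σℤ≡sum k _)
  (trans (∑-distrib-+ f g) (sym (cong₂ _+_ (Σℤ≡sum k f) (Σℤ≡sum k g))))

Σ-*ˡ : ∀ k c (f : Fin k → ℤ) → Σℤ k (λ i → c * f i) ≡ c * Σℤ k f
Σ-*ˡ k c f = trans (Σℤ≡sum k _) (sym (trans (cong (c *_) (Σℤ≡sum k f)) (*-distribˡ-sum c f)))

Σ-*ʳ : ∀ k c (f : Fin k → ℤ) → Σℤ k (λ i → f i * c) ≡ Σℤ k f * c
Σ-*ʳ k c f = trans (Σ-cong k (λ i → ℤP.*-comm (f i) c)) (trans (Σ-*ˡ k c f) (ℤP.*-comm c _))

Σ-swap : ∀ a b (F : Fin a → Fin b → ℤ) →
  Σℤ a (λ i → Σℤ b (F i)) ≡ Σℤ b (λ j → Σℤ a (λ i → F i j))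
Σ-swap a b F = begin
  Σℤ a (λ i → Σℤ b (F i))           ≡⟨ Σ-cong a (λ i → Σℤ≡sum b (F i)) ⟩
  Σℤ a (λ i → sum (F i))            ≡⟨ Σℤ≡sum a _ ⟩
  sum (λ i → sum (F i))             ≡⟨ ∑-comm F ⟩
  sum (λ j → sum (λ i → F i j))     ≡⟨ sym (Σℤ≡sum b _) ⟩
  Σℤ b (λ j → sum (λ i → F i j))    ≡⟨ sym (Σ-cong b (λ j → Σℤ≡sum a (λ i → F i j))) ⟩
  Σℤ b (λ j → Σℤ a (λ i → F i j))   ∎
  where open ≡-Reasoning

ind-sym : ∀ {m} (a b : Fin m) → ind a b ≡ ind b a
ind-sym a b with a ≟ b | b ≟ a
... | yes _ | yes _ = refl
... | no  _ | no  _ = refl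
... | yes p | no ¬q = ⊥-elim (¬q (sym p))
... | no ¬p | yes q = ⊥-elim (¬p (sym q))

Σ-ind : ∀ k (a : Fin k) (g : Fin k → ℤ) → Σℤ k (λ j → ind a j * g j) ≡ g a
Σ-ind (suc k) Fin.zero g =
  trans (cong (λ t → 1ℤ * g Fin.zero + t) (trans (Σ-cong k (λ i → ℤP.*-zeroˡ (g (Fin.suc i)))) (Σ-zero k)))
        (trans (ℤP.+-identityʳ _) (ℤP.*-identityˡ _))
Σ-ind (suc k) (Fin.suc a) g = trans (ℤP.+-identityˡ _) (Σ-ind k a (λ j → g (Fin.suc j)))

Σ-ind' : ∀ k (a : Fin k) (g : Fin k → ℤ) → Σℤ k (λ j → ind j a * g j) ≡ g a
Σ-ind' k a g = trans (Σ-cong k (λ j → cong (_* g j) (ind-sym j a))) (Σ-ind k a g)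

-- The vector counting (with weights c) the occurrences of the edges
-- E 0, …, E (k-1).  Both ω_C of Defs are of this form.
occ : ∀ {m} k → (Fin k → Fin m) → (Fin k → ℤ) → Fin m → ℤ
occ k E c e = Σℤ k (λ i → ind (E i) e * c i)

Σ-occ : ∀ m k (E : Fin k → Fin m) (c : Fin k → ℤ) (F : Fin m → ℤ) →
  Σℤ m (λ j → F j * occ k E c j) ≡ Σℤ k (λ i → F (E i) * c i)
Σ-occ m k E c F = begin
  Σℤ m (λ j → F j * Σℤ k (λ i → ind (E i) j * c i))
    ≡⟨ Σ-cong m (λ j → sym (Σ-*ˡ k (F j) _)) ⟩
  Σℤ m (λ j → Σℤ k (λ i → F j * (ind (E i) j * c i)))
    ≡⟨ Σ-swap m k _ ⟩
  Σℤ k (λ i → Σℤ m (λ j → F j * (ind (E i) j * c i)))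
    ≡⟨ Σ-cong k (λ i → trans (Σ-cong m (λ j → lemma (F j) (ind (E i) j) (c i)))
                              (Σ-ind m (E i) (λ j → F j * c i))) ⟩
  Σℤ k (λ i → F (E i) * c i) ∎
  where
  open ≡-Reasoning
  lemma : ∀ x y z → x * (y * z) ≡ y * (x * z)
  lemma = solve-∀

-- Parity: of indices (the flag evenIdx of Defs) and of lengths, via
-- the sign (-1)^n, which turns parity into multiplication.

2ℤ : ℤ
2ℤ = + 2

evenIdx-suc : ∀ {k} (i : Fin k) → evenIdx (Fin.suc i) ≡ not (evenIdx i)
evenIdx-suc i = flips (toℕ i)
  where
  flips : ∀ n → (suc n ℕDM.% 2 ℕ.≡ᵇ 0) ≡ not (n ℕDM.% 2 ℕ.≡ᵇ 0)
  flips zero          = refl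
  flips (suc zero)    = refl
  flips (suc (suc n)) = flips n

if-evenIdx-suc : ∀ {k} (i : Fin k) (x y : ℤ) →
  (if evenIdx (Fin.suc i) then x else y) ≡ (if evenIdx i then y else x)
if-evenIdx-suc i x y rewrite evenIdx-suc i with evenIdx i
... | true  = refl
... | false = refl

coefficient-suc : ∀ {k} (i : Fin k) →
  (if evenIdx (Fin.suc i) then 1ℤ else -1ℤ) ≡ -1ℤ * (if evenIdx i then 1ℤ else -1ℤ)
coefficient-suc i rewrite evenIdx-suc i with evenIdx i
... | true  = refl
... | false = refl

sign : ℕ → ℤ
sign zero    = 1ℤ
sign (suc n) = - sign n

sign-+ : ∀ a b → sign (a ℕ.+ b) ≡ sign a * sign b
sign-+ zero    b = sym (ℤP.*-identityˡ (sign b))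
sign-+ (suc a) b = trans (cong -_ (sign-+ a b)) (ℤP.neg-distribˡ-* (sign a) (sign b))

sign-sq : ∀ a → sign a * sign a ≡ 1ℤ
sign-sq zero    = refl
sign-sq (suc a) = trans (lemma (sign a)) (sign-sq a)
  where
  lemma : ∀ x → - x * - x ≡ x * x
  lemma = solve-∀

sign-even : ∀ n → Even n → sign n ≡ 1ℤ
sign-even _ (ℕD.divides q refl) = doubled q
  where
  doubled : ∀ q → sign (q ℕ.* 2) ≡ 1ℤ
  doubled zero    = refl
  doubled (suc q) = trans (ℤP.neg-involutive _) (doubled q)

even-of-sign : ∀ n → sign n ≡ 1ℤ → Even n
even-of-sign zero          _ = ℕD.divides 0 refl
even-of-sign (suc (suc n)) p =
  ℕD.∣m∣n⇒∣m+n (ℕD.∣-refl {2}) (even-of-sign n (trans (sym (ℤP.neg-involutive _)) p))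

sign-odd : ∀ n → Odd n → sign n ≡ -1ℤ
sign-odd zero          odd = ⊥-elim (odd (ℕD.divides 0 refl))
sign-odd (suc zero)    odd = refl
sign-odd (suc (suc n)) odd =
  trans (ℤP.neg-involutive _) (sign-odd n (λ ev → odd (ℕD.∣m∣n⇒∣m+n (ℕD.∣-refl {2}) ev)))

-- Alternating sums g 0 - g 1 + g 2 - …; both the even cycle property and
-- the pairing of ω_C with an even cycle reduce to them.

altΣ : ∀ k → (Fin k → ℤ) → ℤ
altΣ zero    g = 0ℤ
altΣ (suc k) g = g Fin.zero - altΣ k (λ i → g (Fin.suc i))

alt-split : ∀ k (g : Fin k → ℤ) →
  Σℤ k (λ i → if evenIdx i then g i else 0ℤ) - Σℤ k (λ i → if evenIdx i then 0ℤ else g i)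
    ≡ altΣ k g
alt-split zero    g = refl
alt-split (suc k) g = begin
  g₀ + Σℤ k (λ i → if evenIdx (Fin.suc i) then g (Fin.suc i) else 0ℤ)
    - (0ℤ + Σℤ k (λ i → if evenIdx (Fin.suc i) then 0ℤ else g (Fin.suc i)))
    ≡⟨ cong₂ (λ a b → g₀ + a - (0ℤ + b)) (Σ-cong k (λ i → if-evenIdx-suc i _ _))
                                          (Σ-cong k (λ i → if-evenIdx-suc i _ _)) ⟩
  g₀ + Odds - (0ℤ + Evens)  ≡⟨ lemma g₀ Evens Odds ⟩
  g₀ - (Evens - Odds)       ≡⟨ cong (λ t → g₀ - t) (alt-split k (λ i → g (Fin.suc i))) ⟩
  altΣ (suc k) g            ∎
  where
  open ≡-Reasoning
  g₀ = g Fin.zero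
  Evens = Σℤ k (λ i → if evenIdx i then g (Fin.suc i) else 0ℤ)
  Odds  = Σℤ k (λ i → if evenIdx i then 0ℤ else g (Fin.suc i))
  lemma : ∀ a x y → a + y - (0ℤ + x) ≡ a - (x - y)
  lemma = solve-∀

alt-signed : ∀ k (h : Fin k → ℤ) →
  Σℤ k (λ i → h i * (if evenIdx i then 1ℤ else -1ℤ)) ≡ altΣ k h
alt-signed zero    h = refl
alt-signed (suc k) h = begin
  h₀ * 1ℤ + Σℤ k (λ i → h (Fin.suc i) * (if evenIdx (Fin.suc i) then 1ℤ else -1ℤ))
    ≡⟨ cong (λ t → h₀ * 1ℤ + t) (Σ-cong k (λ i →
         trans (cong (h (Fin.suc i) *_) (coefficient-suc i)) (lemma₁ (h (Fin.suc i)) (s i)))) ⟩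
  h₀ * 1ℤ + Σℤ k (λ i → -1ℤ * (h (Fin.suc i) * s i))
    ≡⟨ cong (λ t → h₀ * 1ℤ + t) (Σ-*ˡ k -1ℤ _) ⟩
  h₀ * 1ℤ + -1ℤ * Σℤ k (λ i → h (Fin.suc i) * s i)
    ≡⟨ lemma₂ h₀ _ ⟩
  h₀ - Σℤ k (λ i → h (Fin.suc i) * s i)
    ≡⟨ cong (λ t → h₀ - t) (alt-signed k (λ i → h (Fin.suc i))) ⟩
  altΣ (suc k) h ∎
  where
  open ≡-Reasoning
  h₀ = h Fin.zero
  s : Fin k → ℤ
  s i = if evenIdx i then 1ℤ else -1ℤ
  lemma₁ : ∀ x y → x * (-1ℤ * y) ≡ -1ℤ * (x * y)
  lemma₁ = solve-∀
  lemma₂ : ∀ a y → a * 1ℤ + -1ℤ * y ≡ a - y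
  lemma₂ = solve-∀

sum-alt-parity : ∀ k (g : Fin k → ℤ) → 2ℤ ∣ Σℤ k g - altΣ k g
sum-alt-parity zero    g = divides 0ℤ refl
sum-alt-parity (suc k) g =
  subst (2ℤ ∣_) (lemma (g Fin.zero) (Σℤ k (λ i → g (Fin.suc i))) (altΣ k (λ i → g (Fin.suc i))))
        (∣m∣n⇒∣m+n (sum-alt-parity k (λ i → g (Fin.suc i))) (∣n⇒∣m*n (altΣ k (λ i → g (Fin.suc i))) ∣-refl))
  where
  lemma : ∀ a S A → (S - A) + A * 2ℤ ≡ (a + S) - (a - A)
  lemma = solve-∀

tele-alt : ∀ k (g : Fin (suc k) → ℤ) →
  altΣ k (λ i → g (inject₁ i) + g (Fin.suc i)) ≡ g Fin.zero - sign k * g (fromℕ k)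
tele-alt zero    g = sym (trans (cong (λ t → g Fin.zero - t) (ℤP.*-identityˡ (g Fin.zero)))
                                (ℤP.+-inverseʳ (g Fin.zero)))
tele-alt (suc k) g =
  trans (cong (λ t → g Fin.zero + g (Fin.suc Fin.zero) - t) (tele-alt k (λ i → g (Fin.suc i))))
        (lemma (g Fin.zero) (g (Fin.suc Fin.zero)) (sign k) (g (Fin.suc (fromℕ k))))
  where
  lemma : ∀ a b s x → a + b - (b - s * x) ≡ a - (- s) * x
  lemma = solve-∀

tele-sum : ∀ k (g : Fin (suc k) → ℤ) →
  Σℤ k (λ i → g (inject₁ i) + g (Fin.suc i))
    ≡ 2ℤ * Σℤ k (λ i → g (inject₁ i)) - g Fin.zero + g (fromℕ k)
tele-sum zero    g = sym (lemma (g Fin.zero))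
  where
  lemma : ∀ a → 2ℤ * 0ℤ - a + a ≡ 0ℤ
  lemma = solve-∀
tele-sum (suc k) g =
  trans (cong (λ t → g Fin.zero + g (Fin.suc Fin.zero) + t) (tele-sum k (λ i → g (Fin.suc i))))
        (lemma (g Fin.zero) (g (Fin.suc Fin.zero))
               (Σℤ k (λ i → g (Fin.suc (inject₁ i)))) (g (Fin.suc (fromℕ k))))
  where
  lemma : ∀ a b S x → a + b + (2ℤ * S - b + x) ≡ 2ℤ * (a + S) - a + x
  lemma = solve-∀

-- The role of 2 modulo d: for even d the half d/2 detects parity, for
-- odd d the number 2 is invertible.

twice-half : ∀ d → Even d → 2ℤ * + (d ℕDM./ 2) ≡ + d
twice-half d ev = trans (sym (ℤP.pos-* 2 (d ℕDM./ 2))) (cong +_ (ℕDM.m*[n/m]≡n ev))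

half-multiple-even : ∀ d .{{_ : NonZero d}} → Even d → ∀ S → + (d ℕDM./ 2) * S ≈[ d ] 0ℤ → 2ℤ ∣ S
half-multiple-even d ev S (congruent (divides k eq)) with d ℕDM./ 2 in half≡
... | zero  = ⊥-elim (ℕ.≢-nonZero⁻¹ d (ℤP.+-injective (trans (sym (twice-half d ev))
                                                          (cong (λ h → 2ℤ * + h) half≡))))
... | suc h = divides k (ℤP.*-cancelˡ-≡ (+ suc h) S (k * 2ℤ) (begin
  + suc h * S            ≡⟨ sym (ℤP.+-identityʳ _) ⟩
  + suc h * S - 0ℤ       ≡⟨ eq ⟩
  k * + d                ≡⟨ cong (k *_) (sym (twice-half d ev)) ⟩
  k * (2ℤ * + (d ℕDM./ 2)) ≡⟨ cong (λ t → k * (2ℤ * + t)) half≡ ⟩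
  k * (2ℤ * + suc h)     ≡⟨ lemma k (+ suc h) ⟩
  + suc h * (k * 2ℤ)     ∎))
  where
  open ≡-Reasoning
  lemma : ∀ k H → k * (2ℤ * H) ≡ H * (k * 2ℤ)
  lemma = solve-∀

even-half-multiple : ∀ d → Even d → ∀ {S} → 2ℤ ∣ S → + (d ℕDM./ 2) * S ≈[ d ] 0ℤ
even-half-multiple d ev (divides k refl) = mod-by-multiple k
  (trans (lemma (+ (d ℕDM./ 2)) k) (cong (λ t → 0ℤ + k * t) (twice-half d ev)))
  where
  lemma : ∀ H k → H * (k * 2ℤ) ≡ 0ℤ + k * (2ℤ * H)
  lemma = solve-∀

even-modulus : ∀ {d z} → Even d → + d ∣ z → 2ℤ ∣ z
even-modulus ev d∣z = ∣-trans (∣ᵤ⇒∣ ev) d∣z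

odd-decomposition : ∀ d → Odd d → + d ≡ 1ℤ + 2ℤ * + (d ℕDM./ 2)
odd-decomposition d odd with d ℕDM.% 2 in rem | ℕDM.m%n<n d 2
... | zero        | _ = ⊥-elim (odd (ℕD.m%n≡0⇒n∣m d 2 rem))
... | suc (suc _) | ℕ.s≤s (ℕ.s≤s ())
... | suc zero    | _ = begin
  + d                               ≡⟨ cong +_ (ℕDM.m≡m%n+[m/n]*n d 2) ⟩
  + (d ℕDM.% 2 ℕ.+ h ℕ.* 2)          ≡⟨ cong (λ r → + (r ℕ.+ h ℕ.* 2)) rem ⟩
  + (1 ℕ.+ h ℕ.* 2)                 ≡⟨ ℤP.pos-+ 1 _ ⟩
  1ℤ + + (h ℕ.* 2)                  ≡⟨ cong (λ u → 1ℤ + u) (trans (ℤP.pos-* h 2) (ℤP.*-comm (+ h) 2ℤ)) ⟩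
  1ℤ + 2ℤ * + h                     ∎
  where
  open ≡-Reasoning
  h = d ℕDM./ 2

-- for odd d, 2 is invertible mod d: x ≡ 2·(x·(1 + d/2)) since 2·(1 + d/2) = 1 + d
odd-halvable : ∀ d → Odd d → ∀ x → Σ ℤ λ c → x ≈[ d ] 2ℤ * c
odd-halvable d odd x = x * (1ℤ + t) , mod-by-multiple (- x) (begin
  x                                         ≡⟨ lemma x t ⟩
  2ℤ * (x * (1ℤ + t)) + - x * (1ℤ + 2ℤ * t)  ≡⟨ cong (λ D → 2ℤ * (x * (1ℤ + t)) + - x * D) (sym (odd-decomposition d odd)) ⟩
  2ℤ * (x * (1ℤ + t)) + - x * + d            ∎)
  where
  open ≡-Reasoning
  t = + (d ℕDM./ 2)
  lemma : ∀ x t → x ≡ 2ℤ * (x * (1ℤ + t)) + - x * (1ℤ + 2ℤ * t)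
  lemma = solve-∀

module _ {n m : ℕ} (G : Graph n m) where

  incidence-ends : ∀ e v →
    incidence G v e ≡ ind v (proj₁ (ends G e)) + ind v (proj₂ (ends G e))
  incidence-ends e v with v ≟ proj₁ (ends G e) | v ≟ proj₂ (ends G e)
  ... | yes p | yes q = ⊥-elim (noLoop G e (trans (sym p) q))
  ... | yes _ | no  _ = refl
  ... | no  _ | yes _ = refl
  ... | no  _ | no  _ = refl

  incidence-joins : ∀ {e u w} → Joins G e u w → ∀ v → incidence G v e ≡ ind v u + ind v w
  incidence-joins {e} (inj₁ (p , q)) v =
    trans (incidence-ends e v) (cong₂ (λ a b → ind v a + ind v b) p q)
  incidence-joins {e} {u} {w} (inj₂ (p , q)) v =
    trans (incidence-ends e v) (trans (cong₂ (λ a b → ind v a + ind v b) p q) (ℤP.+-comm (ind v w) (ind v u)))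

  incidence-column : ∀ (V : Fin n → ℤ) e →
    Σℤ n (λ v → incidence G v e * V v) ≡ V (proj₁ (ends G e)) + V (proj₂ (ends G e))
  incidence-column V e =
    trans (Σ-cong n (λ v → trans (cong (_* V v) (incidence-ends e v))
                                 (ℤP.*-distribʳ-+ (V v) (ind v (proj₁ (ends G e))) _)))
          (trans (Σ-+ n _ _) (cong₂ _+_ (Σ-ind' n _ V) (Σ-ind' n _ V)))

  incidence-walk : ∀ (W : Walk G) (c : Fin (len W) → ℤ) v →
    Σℤ m (λ j → incidence G v j * occ (len W) (edges W) c j)
      ≡ Σℤ (len W) (λ i → (ind v (verts W (inject₁ i)) + ind v (verts W (Fin.suc i))) * c i)
  incidence-walk W c v = trans (Σ-occ m (len W) (edges W) c (incidence G v))
    (Σ-cong (len W) (λ i → cong (_* c i) (incidence-joins (adj W i) v)))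

pairing-occ : ∀ m k (E : Fin k → Fin m) (c : Fin k → ℤ) (F : Fin m → ℤ) →
  Σℤ m (λ j → occ k E c j * F j) ≡ Σℤ k (λ i → F (E i) * c i)
pairing-occ m k E c F = trans (Σ-cong m (λ j → ℤP.*-comm _ (F j))) (Σ-occ m k E c F)

module _ {n m : ℕ} {G : Graph n m} (C : Cycle G) where
  private
    W = walk C
    k = len W

  cycAlt cycSum : (Fin m → ℤ) → ℤ
  cycAlt F = altΣ k (λ i → F (cycEdge C i))
  cycSum F = Σℤ k (λ i → F (cycEdge C i))

  -- with alternating signs, the vertex counts along an even closed walk
  -- telescope to 0: ω_C ∈ ker_ℤ(A_G)
  ωEven-kernel : EvenCycle C → InKerℤ G (ωEven C)
  ωEven-kernel ev v = begin
    Σℤ m (λ j → incidence G v j * ωEven C j)             ≡⟨ incidence-walk G W σ v ⟩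
    Σℤ k (λ i → (g (inject₁ i) + g (Fin.suc i)) * σ i)   ≡⟨ alt-signed k _ ⟩
    altΣ k (λ i → g (inject₁ i) + g (Fin.suc i))          ≡⟨ tele-alt k g ⟩
    g Fin.zero - sign k * g (fromℕ k)
      ≡⟨ cong₂ (λ s x → g Fin.zero - s * x) (sign-even k ev) (cong (ind v) (closed C)) ⟩
    g Fin.zero - 1ℤ * g Fin.zero                          ≡⟨ lemma (g Fin.zero) ⟩
    0ℤ                                                    ∎
    where
    open ≡-Reasoning
    g : Fin (suc k) → ℤ
    g i = ind v (verts W i)
    σ : Fin k → ℤ
    σ i = if evenIdx i then 1ℤ else -1ℤ
    lemma : ∀ a → a - 1ℤ * a ≡ 0ℤ
    lemma = solve-∀

  -- for even d, ω_C of any cycle lies in ker_{ℤ_d}(A_G): every vertex is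
  -- met an even number of times, and 2·(d/2) = d
  ωOdd-kernel : ∀ d → Even d → ∀ v → Σℤ m (λ j → incidence G v j * ωOdd d C j) ≈[ d ] 0ℤ
  ωOdd-kernel d ev v = mod-by-multiple X (begin
    Σℤ m (λ j → incidence G v j * ωOdd d C j)            ≡⟨ incidence-walk G W (λ _ → H) v ⟩
    Σℤ k (λ i → (g (inject₁ i) + g (Fin.suc i)) * H)      ≡⟨ Σ-*ʳ k H _ ⟩
    Σℤ k (λ i → g (inject₁ i) + g (Fin.suc i)) * H        ≡⟨ cong (_* H) (tele-sum k g) ⟩
    (2ℤ * X - g Fin.zero + g (fromℕ k)) * H
      ≡⟨ cong (λ t → (2ℤ * X - g Fin.zero + t) * H) (cong (ind v) (closed C)) ⟩
    (2ℤ * X - g Fin.zero + g Fin.zero) * H                ≡⟨ lemma X (g Fin.zero) H ⟩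
    0ℤ + X * (2ℤ * H)                                     ≡⟨ cong (λ t → 0ℤ + X * t) (twice-half d ev) ⟩
    0ℤ + X * + d                                          ∎)
    where
    open ≡-Reasoning
    g : Fin (suc k) → ℤ
    g i = ind v (verts W i)
    H = + (d ℕDM./ 2)
    X = Σℤ k (λ i → g (inject₁ i))
    lemma : ∀ X a H → (2ℤ * X - a + a) * H ≡ 0ℤ + X * (2ℤ * H)
    lemma = solve-∀

  ωEven-pairing : ∀ {d} (fE : ELabel d n m) → ⟨ ωEven C , fE ⟩ ≡ cycAlt (λ e → ⌜ fE e ⌝)
  ωEven-pairing fE = trans (pairing-occ m k (edges W) _ (λ e → ⌜ fE e ⌝)) (alt-signed k _)

  ωOdd-pairing : ∀ d (fE : ELabel d n m) →
    ⟨ ωOdd d C , fE ⟩ ≡ + (d ℕDM./ 2) * cycSum (λ e → ⌜ fE e ⌝)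
  ωOdd-pairing d fE = trans (pairing-occ m k (edges W) _ (λ e → ⌜ fE e ⌝))
    (trans (Σ-cong k (λ i → ℤP.*-comm ⌜ fE (cycEdge C i) ⌝ (+ (d ℕDM./ 2))))
           (Σ-*ˡ k (+ (d ℕDM./ 2)) (λ i → ⌜ fE (cycEdge C i) ⌝)))

π-pairing : ∀ d .{{_ : NonZero d}} {m} (ω : Fin m → ℤ) (fE : Fin m → Fin d) →
  ⟨ π d ω , fE ⟩d ≈[ d ] ⟨ ω , fE ⟩
π-pairing d {m} ω fE = Σ-cong-≈ m (λ j → ≈-* (red-≈ d (ω j)) ≈-refl)

π-kernel : ∀ d .{{_ : NonZero d}} {n m} (G : Graph n m) (x : Fin m → ℤ) →
  (∀ v → Σℤ m (λ j → incidence G v j * x j) ≈[ d ] 0ℤ) → InKerℤd d G (π d x)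
π-kernel d {m = m} G x ker v =
  toMod (≈-trans (Σ-cong-≈ m (λ j → ≈-* (≈-refl {x = incidence G v j}) (red-≈ d (x j)))) (ker v))

-- Defs describes walks by index
-- functions; the inductive form makes concatenation and reversal, and
-- hence the construction of closed walks below, straightforward.

module Paths {n m : ℕ} (G : Graph n m) where

  data Path : Fin n → Fin n → Set where
    nil  : ∀ {u} → Path u u
    step : ∀ {u w v} (e : Fin m) → Joins G e u w → Path w v → Path u v

  plen : ∀ {u v} → Path u v → ℕ
  plen nil          = zero
  plen (step _ _ p) = suc (plen p)

  edge : ∀ {u v} (p : Path u v) → Fin (plen p) → Fin m
  edge (step e _ p) Fin.zero    = e
  edge (step e _ p) (Fin.suc i) = edge p i

  vertex : ∀ {u v} (p : Path u v) → Fin (suc (plen p)) → Fin n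
  vertex {u} nil          _           = u
  vertex {u} (step _ _ p) Fin.zero    = u
  vertex     (step _ _ p) (Fin.suc i) = vertex p i

  vertex-first : ∀ {u v} (p : Path u v) → vertex p Fin.zero ≡ u
  vertex-first nil          = refl
  vertex-first (step _ _ _) = refl

  vertex-last : ∀ {u v} (p : Path u v) → vertex p (fromℕ (plen p)) ≡ v
  vertex-last nil          = refl
  vertex-last (step _ _ p) = vertex-last p

  vertex-adj : ∀ {u v} (p : Path u v) i → Joins G (edge p i) (vertex p (inject₁ i)) (vertex p (Fin.suc i))
  vertex-adj (step {u} e j p) Fin.zero    = subst (Joins G e u) (sym (vertex-first p)) j
  vertex-adj (step e j p)     (Fin.suc i) = vertex-adj p i

  closedCycle : ∀ {u} (p : Path u u) → 1 ℕ.≤ plen p → Cycle G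
  closedCycle p nonempty = record
    { walk     = record { len = plen p ; verts = vertex p ; edges = edge p ; adj = vertex-adj p }
    ; nonempty = nonempty
    ; closed   = trans (vertex-last p) (sym (vertex-first p)) }

  walk→path : ∀ k (vs : Fin (suc k) → Fin n) (es : Fin k → Fin m) →
    (∀ i → Joins G (es i) (vs (inject₁ i)) (vs (Fin.suc i))) → Path (vs Fin.zero) (vs (fromℕ k))
  walk→path zero    vs es adj = nil
  walk→path (suc k) vs es adj =
    step (es Fin.zero) (adj Fin.zero) (walk→path k (λ i → vs (Fin.suc i)) (λ i → es (Fin.suc i)) (λ i → adj (Fin.suc i)))

  fromWalk : ∀ {u v} (W : Walk G) → verts W Fin.zero ≡ u → verts W (fromℕ (len W)) ≡ v → Path u v
  fromWalk W refl refl = walk→path (len W) (verts W) (edges W) (adj W)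

  connect : Connected G → ∀ u v → Path u v
  connect conn u v = fromWalk (proj₁ (conn u v)) (proj₁ (proj₂ (conn u v))) (proj₂ (proj₂ (conn u v)))

  cyclePath : (C : Cycle G) → Path (verts (walk C) Fin.zero) (verts (walk C) Fin.zero)
  cyclePath C = fromWalk (walk C) refl (closed C)

  infixr 5 _++_
  _++_ : ∀ {u v w} → Path u v → Path v w → Path u w
  nil          ++ q = q
  step e j p   ++ q = step e j (p ++ q)

  rev : ∀ {u v} → Path u v → Path v u
  rev nil          = nil
  rev (step e j p) = rev p ++ step e (swap j) nil
    where
    swap : ∀ {e u w} → Joins G e u w → Joins G e w u
    swap (inj₁ x) = inj₂ x
    swap (inj₂ x) = inj₁ x

  plen-++ : ∀ {u v w} (p : Path u v) (q : Path v w) → plen (p ++ q) ≡ plen p ℕ.+ plen q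
  plen-++ nil          q = refl
  plen-++ (step _ _ p) q = cong suc (plen-++ p q)

  plen-rev : ∀ {u v} (p : Path u v) → plen (rev p) ≡ plen p
  plen-rev nil          = refl
  plen-rev (step e j p) = trans (plen-++ (rev p) _) (trans (cong (ℕ._+ 1) (plen-rev p)) (ℕP.+-comm (plen p) 1))

  sign-++ : ∀ {u v w} (p : Path u v) (q : Path v w) → sign (plen (p ++ q)) ≡ sign (plen p) * sign (plen q)
  sign-++ p q = trans (cong sign (plen-++ p q)) (sign-+ (plen p) (plen q))

  sign-rev : ∀ {u v} (p : Path u v) → sign (plen (rev p)) ≡ sign (plen p)
  sign-rev p = cong sign (plen-rev p)

  plen-fromWalk : ∀ {u v} (W : Walk G) (a : verts W Fin.zero ≡ u) (b : verts W (fromℕ (len W)) ≡ v) →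
    plen (fromWalk W a b) ≡ len W
  plen-fromWalk W refl refl = go (len W) (verts W) (edges W) (adj W)
    where
    go : ∀ k vs es adj → plen (walk→path k vs es adj) ≡ k
    go zero    vs es adj = refl
    go (suc k) vs es adj = cong suc (go k _ _ _)

  plen-cyclePath : (C : Cycle G) → plen (cyclePath C) ≡ cycLen C
  plen-cyclePath C = plen-fromWalk (walk C) refl (closed C)

  module Weighted (F : Fin m → ℤ) where

    pathSum pathAlt : ∀ {u v} → Path u v → ℤ
    pathSum p = Σℤ (plen p) (λ i → F (edge p i))
    pathAlt p = altΣ (plen p) (λ i → F (edge p i))

    pathSum-++ : ∀ {u v w} (p : Path u v) (q : Path v w) → pathSum (p ++ q) ≡ pathSum p + pathSum q
    pathSum-++ nil          q = sym (ℤP.+-identityˡ _)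
    pathSum-++ (step e _ p) q = trans (cong (λ t → F e + t) (pathSum-++ p q)) (sym (ℤP.+-assoc (F e) _ _))

    pathSum-rev : ∀ {u v} (p : Path u v) → pathSum (rev p) ≡ pathSum p
    pathSum-rev nil          = refl
    pathSum-rev (step e j p) =
      trans (pathSum-++ (rev p) _) (trans (cong₂ _+_ (pathSum-rev p) (ℤP.+-identityʳ (F e))) (ℤP.+-comm _ (F e)))

    pathSum-fromWalk : ∀ {u v} (W : Walk G) (a : verts W Fin.zero ≡ u) (b : verts W (fromℕ (len W)) ≡ v) →
      pathSum (fromWalk W a b) ≡ Σℤ (len W) (λ i → F (edges W i))
    pathSum-fromWalk W refl refl = go (len W) (verts W) (edges W) (adj W)
      where
      go : ∀ k vs es adj → pathSum (walk→path k vs es adj) ≡ Σℤ k (λ i → F (es i))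
      go zero    vs es adj = refl
      go (suc k) vs es adj = cong (λ t → F (es Fin.zero) + t) (go k _ _ _)

    pathSum-cyclePath : (C : Cycle G) → pathSum (cyclePath C) ≡ cycSum C F
    pathSum-cyclePath C = pathSum-fromWalk (walk C) refl (closed C)

    -- Transport of a vertex value along a path: crossing the edge e
    -- turns the value x at one end into F e - x at the other, which is
    -- what a valid v-labelling must do.
    transport : ∀ {u v} → Path u v → ℤ → ℤ
    transport nil          x = x
    transport (step e _ p) x = transport p (F e - x)

    transport-++ : ∀ {u v w} (p : Path u v) (q : Path v w) x →
      transport (p ++ q) x ≡ transport q (transport p x)
    transport-++ nil          q x = refl
    transport-++ (step e _ p) q x = transport-++ p q (F e - x)

    transport-rev : ∀ {u v} (p : Path u v) y → transport p (transport (rev p) y) ≡ y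
    transport-rev nil          y = refl
    transport-rev (step e j p) y = begin
      transport p (F e - transport (rev p ++ _) y)    ≡⟨ cong (λ t → transport p (F e - t)) (transport-++ (rev p) _ y) ⟩
      transport p (F e - (F e - transport (rev p) y)) ≡⟨ cong (transport p) (lemma (F e) _) ⟩
      transport p (transport (rev p) y)               ≡⟨ transport-rev p y ⟩
      y                                               ∎
      where
      open ≡-Reasoning
      lemma : ∀ a z → a - (a - z) ≡ z
      lemma = solve-∀

    transport-formula : ∀ {u v} (p : Path u v) x → transport p x ≡ sign (plen p) * (x - pathAlt p)
    transport-formula nil          x = lemma x
      where
      lemma : ∀ x → x ≡ 1ℤ * (x - 0ℤ)
      lemma = solve-∀
    transport-formula (step e _ p) x =
      trans (transport-formula p (F e - x)) (lemma (sign (plen p)) (F e) x (pathAlt p))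
      where
      lemma : ∀ s f x a → s * (f - x - a) ≡ - s * (x - (f - a))
      lemma = solve-∀

    transport-≈ : ∀ {d u v} (p : Path u v) {x y} → x ≈[ d ] y → transport p x ≈[ d ] transport p y
    transport-≈ p {x} {y} x≈y = ≈-trans (≡⇒≈ (transport-formula p x))
      (≈-trans (≈-* (≈-refl {x = sign (plen p)}) (≈-- x≈y (≈-refl {x = pathAlt p}))) (≡⇒≈ (sym (transport-formula p y))))

module Implications (d : ℕ) .{{_ : NonZero d}} {n m : ℕ} (G : Graph n m) (fE : ELabel d n m) where
  open Paths G
  F : Fin m → ℤ
  F e = ⌜ fE e ⌝
  open Weighted F

  even-property⇔alt : ∀ (C : Cycle G) →
    (Σℤ (cycLen C) (λ i → if evenIdx i then F (cycEdge C i) else 0ℤ)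
      ≡ Σℤ (cycLen C) (λ i → if evenIdx i then 0ℤ else F (cycEdge C i)) [mod d ])
    ⇔ cycAlt C F ≈[ d ] 0ℤ
  even-property⇔alt C = mk⇔
    (λ p → mod-via (sym (trans (ℤP.+-identityʳ _) (sym (alt-split k g)))) (∣ᵤ⇒∣ p))
    (λ p → ∣⇒∣ᵤ (subst (+ d ∣_) (trans (ℤP.+-identityʳ _) (sym (alt-split k g))) (divisible p)))
    where
    k = cycLen C
    g : Fin k → ℤ
    g i = F (cycEdge C i)

  even-property : Compatible G fE → EvenCycleProperty G fE
  even-property (inj₁ (_ , ep))     = ep
  even-property (inj₂ (_ , ep , _)) = ep

  reduced-pairing : ∀ ω {z} → ⟨ ω , fE ⟩ ≡ z → ⟨ π d ω , fE ⟩d ≈[ d ] z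
  reduced-pairing ω eq = ≈-trans (π-pairing d ω fE) (≡⇒≈ eq)

  v⇒iii : Cond-v G fE → Cond-iii d G fE
  v⇒iii (fV , valid) ω ker = toMod (begin
    Σℤ m (λ j → ⌜ ω j ⌝ * F j)
      ≈⟨ Σ-cong-≈ m (λ j → ≈-* (≈-refl {x = ⌜ ω j ⌝}) (fromMod (valid j))) ⟩
    Σℤ m (λ j → ⌜ ω j ⌝ * (V (proj₁ (ends G j)) + V (proj₂ (ends G j))))
      ≡⟨ Σ-cong m (λ j → cong (⌜ ω j ⌝ *_) (sym (incidence-column G V j))) ⟩
    Σℤ m (λ j → ⌜ ω j ⌝ * Σℤ n (λ v → incidence G v j * V v))
      ≡⟨ Σ-cong m (λ j → sym (Σ-*ˡ n ⌜ ω j ⌝ _)) ⟩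
    Σℤ m (λ j → Σℤ n (λ v → ⌜ ω j ⌝ * (incidence G v j * V v)))
      ≡⟨ Σ-swap m n _ ⟩
    Σℤ n (λ v → Σℤ m (λ j → ⌜ ω j ⌝ * (incidence G v j * V v)))
      ≡⟨ Σ-cong n (λ v → trans (Σ-cong m (λ j → lemma ⌜ ω j ⌝ (incidence G v j) (V v))) (Σ-*ˡ m (V v) _)) ⟩
    Σℤ n (λ v → V v * Σℤ m (λ j → incidence G v j * ⌜ ω j ⌝))
      ≈⟨ Σ-≈0 n (λ v → ≈-trans (≈-* (≈-refl {x = V v}) (fromMod (ker v))) (≡⇒≈ (ℤP.*-zeroʳ (V v)))) ⟩
    0ℤ ∎)
    where
    open ≈-Reasoning d
    V : Fin n → ℤ
    V v = ⌜ fV v ⌝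
    lemma : ∀ a b c → a * (b * c) ≡ c * (b * a)
    lemma = solve-∀

  iii⇒ii : Cond-iii d G fE → Cond-ii d G fE
  iii⇒ii h = (λ C ev → h (π d (ωEven C)) (π-kernel d G _ (λ v → ≡⇒≈ (ωEven-kernel C ev v))))
           , (λ ev C odd → h (π d (ωOdd d C)) (π-kernel d G _ (ωOdd-kernel C d ev)))

  ii⇒even-property : (∀ (C : Cycle G) → EvenCycle C → ⟨ π d (ωEven C) , fE ⟩d ≡ 0ℤ [mod d ]) →
    EvenCycleProperty G fE
  ii⇒even-property evenC C ev = Equivalence.from (even-property⇔alt C)
    (≈-trans (≈-sym (reduced-pairing (ωEven C) (ωEven-pairing C fE))) (fromMod (evenC C ev)))

  ii⇒odd-property : Even d →
    (Even d → ∀ (C : Cycle G) → OddCycle C → ⟨ π d (ωOdd d C) , fE ⟩d ≡ 0ℤ [mod d ]) →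
    OddCycleProperty G fE
  ii⇒odd-property ev oddC C odd =
    toMod {y = 0ℤ} (≈-trans (≈-sym (reduced-pairing (ωOdd d C) (ωOdd-pairing C d fE))) (fromMod (oddC ev C odd)))

  ii⇒i : Cond-ii d G fE → Cond-i G fE
  ii⇒i (evenC , oddC) with 2 ℕD.∣? d
  ... | yes ev  = inj₂ (ev , ii⇒even-property evenC , ii⇒odd-property ev oddC)
  ... | no  odd = inj₁ (odd , ii⇒even-property evenC)

  -- Closed walks.  An even closed walk has vanishing alternating sum by
  -- the even cycle property, so transport around it is the identity; an
  -- odd one acts as the reflection x ↦ pathAlt Q - x.

  closed-even-alt : EvenCycleProperty G fE → ∀ {u} (Q : Path u u) → Even (plen Q) → pathAlt Q ≈[ d ] 0ℤ
  closed-even-alt ep nil          _  = ≈-refl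
  closed-even-alt ep Q@(step _ _ _) ev = Equivalence.to (even-property⇔alt C) (ep C ev)
    where
    C = closedCycle Q (ℕ.s≤s ℕ.z≤n)

  even-fixes : EvenCycleProperty G fE → ∀ {u} (Q : Path u u) → Even (plen Q) → ∀ x → transport Q x ≈[ d ] x
  even-fixes ep Q ev x = begin
    transport Q x                    ≡⟨ transport-formula Q x ⟩
    sign (plen Q) * (x - pathAlt Q)  ≡⟨ cong (λ s → s * (x - pathAlt Q)) (sign-even _ ev) ⟩
    1ℤ * (x - pathAlt Q)             ≈⟨ ≈-* (≈-refl {x = 1ℤ}) (≈-- (≈-refl {x = x}) (closed-even-alt ep Q ev)) ⟩
    1ℤ * (x - 0ℤ)                    ≡⟨ lemma x ⟩
    x                                ∎
    where
    open ≈-Reasoning d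
    lemma : ∀ x → 1ℤ * (x - 0ℤ) ≡ x
    lemma = solve-∀

  odd-reflects : ∀ {u v} (Q : Path u v) → Odd (plen Q) → ∀ x → transport Q x ≡ pathAlt Q - x
  odd-reflects Q odd x = trans (transport-formula Q x)
    (trans (cong (λ s → s * (x - pathAlt Q)) (sign-odd _ odd)) (lemma x (pathAlt Q)))
    where
    lemma : ∀ x a → -1ℤ * (x - a) ≡ a - x
    lemma = solve-∀

  -- all odd closed walks at a vertex have congruent alternating sums:
  -- going around one and then the other is an even closed walk
  odd-alt-agree : EvenCycleProperty G fE → ∀ {u} (Q Q′ : Path u u) → Odd (plen Q) → Odd (plen Q′) →
    pathAlt Q ≈[ d ] pathAlt Q′
  odd-alt-agree ep Q Q′ odd odd′ = begin
    pathAlt Q                                       ≡⟨ lemma (pathAlt Q) (pathAlt Q′) ⟩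
    pathAlt Q′ - (pathAlt Q′ - (pathAlt Q - 0ℤ))    ≡⟨ cong (λ t → pathAlt Q′ - t) (sym round-trip) ⟩
    pathAlt Q′ - transport (Q ++ Q′) 0ℤ             ≈⟨ ≈-- (≈-refl {x = pathAlt Q′}) (even-fixes ep (Q ++ Q′) even 0ℤ) ⟩
    pathAlt Q′ - 0ℤ                                 ≡⟨ ℤP.+-identityʳ _ ⟩
    pathAlt Q′                                      ∎
    where
    open ≈-Reasoning d
    even : Even (plen (Q ++ Q′))
    even = even-of-sign _ (trans (sign-++ Q Q′) (cong₂ _*_ (sign-odd _ odd) (sign-odd _ odd′)))
    round-trip : transport (Q ++ Q′) 0ℤ ≡ pathAlt Q′ - (pathAlt Q - 0ℤ)
    round-trip = trans (transport-++ Q Q′ 0ℤ)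
      (trans (odd-reflects Q′ odd′ _) (cong (λ t → pathAlt Q′ - t) (odd-reflects Q odd 0ℤ)))
    lemma : ∀ a b → a ≡ b - (b - (a - 0ℤ))
    lemma = solve-∀

  -- for a compatible labelling, the alternating sum of an odd closed walk
  -- is twice something mod d: for odd d since 2 is a unit, for even d
  -- since the odd cycle property makes its edge sum, hence the
  -- alternating sum, even
  odd-alt-halvable : Compatible G fE → ∀ {u} (Q : Path u u) → Odd (plen Q) →
    Σ ℤ λ c → pathAlt Q ≈[ d ] 2ℤ * c
  odd-alt-halvable (inj₁ (odd-d , _))    Q             _   = odd-halvable d odd-d (pathAlt Q)
  odd-alt-halvable (inj₂ (_ , _ , _))    nil           odd = ⊥-elim (odd (ℕD.divides 0 refl))
  odd-alt-halvable (inj₂ (ev , _ , op))  Q@(step _ _ _) odd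
    with ∣m∣n⇒∣m-n sum-even (sum-alt-parity (plen Q) (λ i → F (edge Q i)))
    where
    sum-even : 2ℤ ∣ pathSum Q
    sum-even = half-multiple-even d ev _ (fromMod (op (closedCycle Q (ℕ.s≤s ℕ.z≤n)) odd))
  ... | divides q eq = q , ≡⇒≈ (trans (lemma (pathSum Q) (pathAlt Q)) (trans eq (ℤP.*-comm q 2ℤ)))
    where
    lemma : ∀ S A → A ≡ S - (S - A)
    lemma = solve-∀

  fixed-point : EvenCycleProperty G fE → ∀ {u} c →
    (∀ (Q : Path u u) → Odd (plen Q) → pathAlt Q ≈[ d ] 2ℤ * c) →
    ∀ (Q : Path u u) → transport Q c ≈[ d ] c
  fixed-point ep c half Q with 2 ℕD.∣? plen Q
  ... | yes ev  = even-fixes ep Q ev c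
  ... | no  odd = begin
    transport Q c  ≡⟨ odd-reflects Q odd c ⟩
    pathAlt Q - c  ≈⟨ ≈-- (half Q odd) (≈-refl {x = c}) ⟩
    2ℤ * c - c     ≡⟨ lemma c ⟩
    c              ∎
    where
    open ≈-Reasoning d
    lemma : ∀ c → 2ℤ * c - c ≡ c
    lemma = solve-∀

  -- For even d and connected G, the even cycle property and a single odd
  -- cycle C₀ with (d/2)·Σ_{C₀} f ≡ 0 give the odd cycle property: for an
  -- odd cycle C and a path P from C₀ to C, the closed walk C₀ · P · C · P⁻¹
  -- is even, so its edge sum Σ C₀ + Σ C + 2 Σ P is even, hence so is Σ C.
  one-odd⇒odd-property : Connected G → Even d → EvenCycleProperty G fE →
    (C₀ : Cycle G) → OddCycle C₀ → + (d ℕDM./ 2) * cycSum C₀ F ≈[ d ] 0ℤ → OddCycleProperty G fE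
  one-odd⇒odd-property conn ev ep C₀ odd₀ h₀ C odd = toMod {y = 0ℤ} (even-half-multiple d ev sum-even)
    where
    p₀ = cyclePath C₀
    p  = cyclePath C
    P  = connect conn (verts (walk C₀) Fin.zero) (verts (walk C) Fin.zero)
    D  = p₀ ++ P ++ p ++ rev P
    D-even : Even (plen D)
    D-even = even-of-sign _ (begin
      sign (plen D)
        ≡⟨ trans (sign-++ p₀ _) (cong (sign (plen p₀) *_) (trans (sign-++ P _)
             (cong (sign (plen P) *_) (trans (sign-++ p _) (cong (sign (plen p) *_) (sign-rev P)))))) ⟩
      sign (plen p₀) * (sign (plen P) * (sign (plen p) * sign (plen P)))
        ≡⟨ cong₂ (λ x y → x * (sign (plen P) * (y * sign (plen P))))
                 (trans (cong sign (plen-cyclePath C₀)) (sign-odd _ odd₀))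
                 (trans (cong sign (plen-cyclePath C)) (sign-odd _ odd)) ⟩
      -1ℤ * (sign (plen P) * (-1ℤ * sign (plen P)))  ≡⟨ lemma (sign (plen P)) ⟩
      sign (plen P) * sign (plen P)                 ≡⟨ sign-sq (plen P) ⟩
      1ℤ                                            ∎)
      where
      open ≡-Reasoning
      lemma : ∀ x → -1ℤ * (x * (-1ℤ * x)) ≡ x * x
      lemma = solve-∀
    -- the alternating sum of D vanishes mod the even d, so it and the edge sum of D are even
    D-sum-even : 2ℤ ∣ pathSum D
    D-sum-even = subst (2ℤ ∣_) (lemma (pathSum D) (pathAlt D))
      (∣m∣n⇒∣m+n (sum-alt-parity (plen D) _) (even-modulus ev (divisible (closed-even-alt ep D D-even))))
      where
      lemma : ∀ S A → (S - A) + (A - 0ℤ) ≡ S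
      lemma = solve-∀
    sum₀-even : 2ℤ ∣ pathSum p₀
    sum₀-even = subst (2ℤ ∣_) (sym (pathSum-cyclePath C₀)) (half-multiple-even d ev _ h₀)
    sum-D : pathSum D ≡ pathSum p₀ + (pathSum P + (pathSum p + pathSum P))
    sum-D = trans (pathSum-++ p₀ _) (cong (λ t → pathSum p₀ + t) (trans (pathSum-++ P _)
      (cong (λ t → pathSum P + t) (trans (pathSum-++ p _) (cong (λ t → pathSum p + t) (pathSum-rev P))))))
    sum-even : 2ℤ ∣ cycSum C F
    sum-even = subst (2ℤ ∣_) (trans (cong (λ t → t - pathSum p₀ - pathSum P * 2ℤ) sum-D)
                                    (trans (lemma (pathSum p₀) (pathSum P) (pathSum p)) (pathSum-cyclePath C)))
      (∣m∣n⇒∣m-n (∣m∣n⇒∣m-n D-sum-even sum₀-even) (∣n⇒∣m*n (pathSum P) ∣-refl))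
      where
      lemma : ∀ a b c → a + (b + (c + b)) - a - b * 2ℤ ≡ c
      lemma = solve-∀

-- Fix the root 0 and a
-- path P v from it to every vertex v, and label v by transporting a root
-- value c along P v.  This is valid on an edge e = (a, b) as soon as
-- transport around the closed walk Q e = P a · e · (P b)⁻¹ fixes c, and
-- a c fixed by all these walks exists by the analysis of closed walks.

module Construction (d : ℕ) .{{_ : NonZero d}} {n m : ℕ} (G : Graph (suc n) m) (conn : Connected G)
                    (fE : ELabel d (suc n) m) where
  open Paths G
  open Implications d G fE
  open Weighted F

  P : ∀ v → Path Fin.zero v
  P = connect conn Fin.zero

  T : ℤ → Fin (suc n) → ℤ
  T c v = transport (P v) c

  Q : Fin m → Path Fin.zero Fin.zero
  Q e = P (proj₁ (ends G e)) ++ step e (inj₁ (refl , refl)) (rev (P (proj₂ (ends G e))))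

  valid-if-fixed : ∀ c → (∀ e → transport (Q e) c ≈[ d ] c) → ValidV G fE (λ v → red d (T c v))
  valid-if-fixed c fixed e = toMod (begin
    F e                                                    ≡⟨ lemma (F e) (T c a) ⟩
    T c a + (F e - T c a)                                  ≡⟨ cong (λ t → T c a + t) (sym (transport-rev (P b) _)) ⟩
    T c a + transport (P b) (transport (rev (P b)) (F e - T c a))
      ≡⟨ cong (λ t → T c a + transport (P b) t) (sym (transport-++ (P a) _ c)) ⟩
    T c a + transport (P b) (transport (Q e) c)            ≈⟨ ≈-+ (≈-refl {x = T c a}) (transport-≈ (P b) (fixed e)) ⟩
    T c a + T c b                                          ≈⟨ ≈-sym (≈-+ (red-≈ d (T c a)) (red-≈ d (T c b))) ⟩
    ⌜ red d (T c a) ⌝ + ⌜ red d (T c b) ⌝                   ∎)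
    where
    open ≈-Reasoning d
    a = proj₁ (ends G e)
    b = proj₂ (ends G e)
    lemma : ∀ f t → f ≡ t + (f - t)
    lemma = solve-∀

  -- if some Q e₀ is odd, half of its alternating sum is fixed by every
  -- closed walk at the root; otherwise all Q e are even and fix anything
  root-value : Compatible G fE → Σ ℤ λ c → ∀ e → transport (Q e) c ≈[ d ] c
  root-value comp with any? (λ e → ¬? (2 ℕD.∣? plen (Q e)))
  ... | yes (e₀ , odd₀) = c , λ e → fixed-point ep c half (Q e)
    where
    ep = even-property comp
    c = proj₁ (odd-alt-halvable comp (Q e₀) odd₀)
    half : ∀ (R : Path Fin.zero Fin.zero) → Odd (plen R) → pathAlt R ≈[ d ] 2ℤ * c
    half R odd = ≈-trans (odd-alt-agree ep R (Q e₀) odd odd₀) (proj₂ (odd-alt-halvable comp (Q e₀) odd₀))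
  ... | no none = 0ℤ , λ e →
    even-fixes (even-property comp) (Q e) (decidable-stable (2 ℕD.∣? _) (λ odd → none (e , odd))) 0ℤ

i⇒v : ∀ d .{{_ : NonZero d}} {n m} (G : Graph n m) → Connected G → (fE : ELabel d n m) →
  Cond-i G fE → Cond-v G fE
i⇒v d {zero}  G _    _  _    = (λ ()) , λ e → ⊥-elim (¬Fin0 (proj₁ (ends G e)))
i⇒v d {suc n} G conn fE comp = (λ v → red d (T c v)) , valid-if-fixed c (proj₂ (root-value comp))
  where
  open Construction d G conn fE
  c = proj₁ (root-value comp)

module Generators (d : ℕ) .{{_ : NonZero d}} {n m : ℕ} (G : Graph n m) (fE : ELabel d n m)
                  (s : ℕ) (S : Fin s → Fin m → ℤ) (gen : GeneratesKer G s S) where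
  open Implications d G fE

  VanishesOnS : Set
  VanishesOnS = ∀ t → ⟨ π d (S t) , fE ⟩d ≡ 0ℤ [mod d ]

  iii⇒iv : Cond-iii d G fE → Cond-iv d G fE s S
  iii⇒iv h = (λ _ → vanishes) , λ { (ev , (C , odd)) → vanishes , C , odd , proj₂ (iii⇒ii h) ev C odd }
    where
    vanishes : VanishesOnS
    vanishes t = h (π d (S t)) (π-kernel d G (S t) (λ v → ≡⇒≈ (proj₁ gen t v)))

  kernel-pairing : VanishesOnS → ∀ x → InKerℤ G x → ⟨ x , fE ⟩ ≈[ d ] 0ℤ
  kernel-pairing vanishes x ker with proj₂ gen x ker
  ... | c , x≡ = begin
    Σℤ m (λ e → x e * F e)                          ≡⟨ Σ-cong m (λ e → cong (_* F e) (x≡ e)) ⟩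
    Σℤ m (λ e → Σℤ s (λ t → c t * S t e) * F e)      ≡⟨ Σ-cong m (λ e → sym (Σ-*ʳ s (F e) _)) ⟩
    Σℤ m (λ e → Σℤ s (λ t → c t * S t e * F e))      ≡⟨ Σ-swap m s _ ⟩
    Σℤ s (λ t → Σℤ m (λ e → c t * S t e * F e))
      ≡⟨ Σ-cong s (λ t → trans (Σ-cong m (λ e → ℤP.*-assoc (c t) (S t e) (F e))) (Σ-*ˡ m (c t) _)) ⟩
    Σℤ s (λ t → c t * ⟨ S t , fE ⟩)
      ≈⟨ Σ-≈0 s (λ t → ≈-trans (≈-* (≈-refl {x = c t}) (≈-trans (≈-sym (π-pairing d (S t) fE)) (fromMod (vanishes t))))
                               (≡⇒≈ (ℤP.*-zeroʳ (c t)))) ⟩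
    0ℤ                                              ∎
    where
    open ≈-Reasoning d

  vanishes⇒even-property : VanishesOnS → EvenCycleProperty G fE
  vanishes⇒even-property vanishes C ev = Equivalence.from (even-property⇔alt C)
    (≈-trans (≡⇒≈ (sym (ωEven-pairing C fE))) (kernel-pairing vanishes (ωEven C) (ωEven-kernel C ev)))

  -- (iv) gives VanishesOnS whether or not G has an odd cycle; that
  -- existence is not decided, so only the double negation follows
  iv⇒¬¬vanishes : Cond-iv d G fE s S → ¬ ¬ VanishesOnS
  iv⇒¬¬vanishes (c₁ , c₂) ¬vanishes with 2 ℕD.∣? d
  ... | no  odd = ¬vanishes (c₁ (inj₁ odd))
  ... | yes ev  = ¬¬-excluded-middle λ
    { (yes hasOdd) → ¬vanishes (proj₁ (c₂ (ev , hasOdd)))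
    ; (no  noOdd)  → ¬vanishes (c₁ (inj₂ noOdd)) }

  -- each instance of the even cycle property is a decidable congruence,
  -- hence stable under double negation
  iv⇒even-property : Cond-iv d G fE s S → EvenCycleProperty G fE
  iv⇒even-property c₄ C ev = decidable-stable (d ℕD.∣? _)
    (λ ¬ep → iv⇒¬¬vanishes c₄ (λ vanishes → ¬ep (vanishes⇒even-property vanishes C ev)))

  iv⇒i : Connected G → Cond-iv d G fE s S → Cond-i G fE
  iv⇒i conn c₄ with 2 ℕD.∣? d
  ... | no  odd = inj₁ (odd , iv⇒even-property c₄)
  ... | yes ev  = inj₂ (ev , iv⇒even-property c₄ , odd-property)
    where
    odd-property : OddCycleProperty G fE
    odd-property C odd with proj₂ c₄ (ev , (C , odd))
    ... | _ , C₀ , odd₀ , h₀ = one-odd⇒odd-property conn ev (iv⇒even-property c₄) C₀ odd₀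
      (≈-trans (≈-sym (reduced-pairing (ωOdd d C₀) (ωOdd-pairing C₀ d fE))) (fromMod h₀)) C odd

theorem3 : (d : ℕ) .{{_ : NonZero d}} (n m : ℕ) (G : Graph n m) → Connected G →
    (fE : ELabel d n m) →
    (Cond-i G fE ⇔ Cond-ii d G fE) ×
    (Cond-i G fE ⇔ Cond-iii d G fE) ×
    (∀ (s : ℕ) (S : Fin s → (Fin m → ℤ)) → GeneratesKer G s S →
       (Cond-i G fE ⇔ Cond-iv d G fE s S)) ×
    (Cond-i G fE ⇔ Cond-v G fE)
theorem3 d n m G conn fE =
  mk⇔ (iii⇒ii ∘ i⇒iii) (ii⇒i) ,
  mk⇔ i⇒iii (ii⇒i ∘ iii⇒ii) ,
  (λ s S gen → let open Generators d G fE s S gen in mk⇔ (iii⇒iv ∘ i⇒iii) (iv⇒i conn)) ,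
  mk⇔ (i⇒v d G conn fE) (ii⇒i ∘ iii⇒ii ∘ v⇒iii)
  where
  open Implications d G fE
  i⇒iii : Cond-i G fE → Cond-iii d G fE
  i⇒iii = v⇒iii ∘ i⇒v d G conn fE
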